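{- Let $n\ge 3$ and let $W=S_n$ be the symmetric group, viewed as the Coxeter group of type $A_{n-1}$ with simple reflections $S=\{s_1,\dots,s_{n-1}\}$, $s_i=(i,\,i+1)$. Let $J=S\setminus\{s_{n-1},s_{n-2}\}$ and let $W_J$ be the parabolic subgroup generated by $J$. For distinct $i,j\in\{1,\dots,n\}$ let $\alpha_{ij}=\varepsilon_i-\varepsilon_j$ be the corresponding root of type $A_{n-1}$, with height $\mathrm{ht}(\alpha_{ij})=j-i$, and let $w_{\alpha_{ij}}\in S_n$ be the permutation whose one-line notation is $w=n\,(n-1)\cdots\hat{j}\cdots\hat{i}\cdots 1\; i\; j$, i.e. the $n-2$ values of $\{1,\dots,n\}\setminus\{i,j\}$ listed in decreasing order, followed by $i$ and then $j$. If $\alpha,\beta$ are roots with $\mathrm{ht}(\alpha)=\mathrm{ht}(\beta)$, then the cosets $w_\alpha W_J$ and $w_\beta W_J$ are comparable in the Bruhat order on the left cosets $W/W_J$, i.e. $w_\alpha\le w_\beta$ or $w_\beta\le w_\alpha$ in the Bruhat order of $S_n$.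
   Context: Permutations are written in one-line notation $w=w(1)w(2)\cdots w(n)$, and composition is right to left, $(uv)(k)=u(v(k))$, so right multiplication by $s_i$ swaps the entries in positions $i$ and $i+1$; hence a left coset $wW_J$ is determined by the last two entries $w(n-1),w(n)$. The roots are $\Phi=\{\varepsilon_i-\varepsilon_j: i\ne j\}$ in $\mathbb{R}^n$ with simple roots $\alpha_i=\varepsilon_i-\varepsilon_{i+1}$; the height of a root $\sum_k c_k\alpha_k$ is $\sum_k c_k$, which for $\varepsilon_i-\varepsilon_j$ equals $j-i$. The element $w_{\alpha}$ is the unique Bruhat-maximal element of its coset $w_\alpha W_J$, and the Bruhat order on $W/W_J$ is the order induced by comparing such maximal coset representatives (equivalently, minimal coset representatives) in the Bruhat order of $S_n$. -}

module Defs where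

open import Data.Nat using (ℕ; zero; suc; _<_; _≟_; _<?_)
open import Data.Fin using (Fin; toℕ)
open import Data.Integer using (ℤ; +_; _-_)
open import Data.List using (List; []; _∷_; _++_; map; filter; length; upTo; reverse)
open import Data.Nat.ListAction using (sum)
open import Data.Bool using (if_then_else_)
open import Data.Product using (∃; ∃-syntax; _×_; _,_)
open import Relation.Nullary using (¬_)
open import Relation.Nullary.Decidable using (⌊_⌋; _×-dec_; ¬?)
open import Relation.Binary.PropositionalEquality using (_≡_)
open import Relation.Binary.Construct.Closure.ReflexiveTransitive using (Star)

-- Permutations of S_n in one-line notation, as lists of length n whose
-- entries are the values 0,1,…,n-1 (0-based: value v stands for v+1).

-- entry in position p (0-based); default 0 out of range
at : List ℕ → ℕ → ℕ
at []       _       = 0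
at (x ∷ xs) zero    = x
at (x ∷ xs) (suc p) = at xs p

-- right multiplication by the transposition (a b) of positions:
-- (w t)(k) = w(t(k)) swaps the entries in positions a and b.
swapPos : ℕ → ℕ → List ℕ → List ℕ
swapPos a b w = map f (upTo (length w))
  where
  f : ℕ → ℕ
  f k = if ⌊ k ≟ a ⌋ then at w b else (if ⌊ k ≟ b ⌋ then at w a else at w k)

-- Coxeter length = number of inversions: pairs of positions p < q with w(p) > w(q)
invCount : List ℕ → ℕ
invCount w = sum (map (λ p → length (filter (λ q → (p <? q) ×-dec (at w q <? at w p))
                                            (upTo (length w))))
                      (upTo (length w)))

BruhatStep : List ℕ → List ℕ → Set
BruhatStep u v = ∃[ a ] ∃[ b ] (a < b × b < length u × v ≡ swapPos a b u × invCount u < invCount v)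

-- Bruhat order on S_n: reflexive-transitive closure of BruhatStep
-- (Björner–Brenti, Definition 2.1.1)
_≤B_ : List ℕ → List ℕ → Set
u ≤B v = Star BruhatStep u v

ht : {n : ℕ} → Fin n → Fin n → ℤ
ht i j = + toℕ j - + toℕ i

wRoot : (n : ℕ) → Fin n → Fin n → List ℕ
wRoot n i j =
  filter (λ v → ¬? (v ≟ toℕ i) ×-dec ¬? (v ≟ toℕ j)) (reverse (upTo n))
  ++ (toℕ i ∷ toℕ j ∷ [])

module Submission where

-- Write W n a b for the permutation w_α of the root α = ε_a - ε_b (0-based
-- values): the values other than a, b in decreasing order, followed by a, b.
-- Two roots of equal height have the form (a, b) and (a + t, b + t), so it
-- suffices to show  W n (a + 1) (b + 1) ≤ W n a b  and iterate.
--
-- The basic Bruhat relation used is: if the value v occurs before v + 1 in a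
-- permutation w, then exchanging these two values is a Bruhat cover.  Indeed
-- the result is w t for the transposition t of their positions, and it is also
-- σ ∘ w for the value transposition σ = (v v+1); since σ preserves the order of
-- every pair of values except {v, v+1}, every inversion of w survives and the
-- pair of positions of v and v + 1 becomes a new one, so the length grows.

open import Defs
open import Data.Nat using (ℕ; _≤_)
open import Data.Fin using (Fin)
open import Data.Sum using (_⊎_)
open import Relation.Binary.PropositionalEquality using (_≡_; _≢_)

open import Level using (0ℓ)
open import Data.Nat using (zero; suc; _+_; _∸_; _<_; _≟_; _<?_; z≤n; s≤s; s≤s⁻¹; z<s; s<s)
open import Data.Nat.Properties
open import Data.Fin using (toℕ)
open import Data.Fin.Properties using (toℕ-injective; toℕ<n)
import Data.Integer as ℤ
open import Data.Integer using (+_; _-_)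
import Data.Integer.Properties as ℤₚ
open import Data.Integer.Tactic.RingSolver using (solve-∀)
open import Data.List using (List; []; _∷_; _++_; map; filter; length; upTo; reverse; applyUpTo; downFrom)
open import Data.List.Properties
  using (++-assoc; length-++; length-map; length-upTo; reverse-upTo; filter-accept; filter-reject;
         filter-++; map-++; map-id-local)
open import Data.List.Relation.Unary.All using (All; []; _∷_)
import Data.List.Relation.Unary.All as All
open import Data.List.Relation.Unary.All.Properties using (++⁺; applyUpTo⁺₁; filter⁺)
open import Data.List.Relation.Unary.Any using (Any; here; there)
open import Data.List.Relation.Unary.Any.Properties using (applyUpTo⁺)
open import Data.Nat.ListAction using (sum)
open import Data.Bool using (if_then_else_)
open import Data.Product using (∃-syntax; _×_; _,_; proj₁; proj₂)
open import Data.Sum using (inj₁; inj₂)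
open import Relation.Binary.Definitions using (tri<; tri≈; tri>)
open import Relation.Nullary using (¬_; yes; no; contradiction)
open import Relation.Nullary.Decidable using (⌊_⌋; _×-dec_; ¬?)
open import Relation.Unary using (Pred; Decidable)
open import Relation.Binary.PropositionalEquality using (refl; sym; trans; cong; cong₂; subst; subst₂; module ≡-Reasoning)
open import Relation.Binary.Construct.Closure.ReflexiveTransitive using (ε; _◅_; _◅◅_)

module _ {P Q : Pred ℕ 0ℓ} (P? : Decidable P) (Q? : Decidable Q) where

  filter-length-mono : ∀ xs → All (λ x → P x → Q x) xs → length (filter P? xs) ≤ length (filter Q? xs)
  filter-length-mono [] [] = z≤n
  filter-length-mono (x ∷ xs) (h ∷ hs) with P? x | Q? x
  ... | yes p | yes q = s≤s (filter-length-mono xs hs)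
  ... | yes p | no ¬q = contradiction (h p) ¬q
  ... | no ¬p | yes q = m≤n⇒m≤1+n (filter-length-mono xs hs)
  ... | no ¬p | no ¬q = filter-length-mono xs hs

  filter-length-strict : ∀ xs → All (λ x → P x → Q x) xs → Any (λ x → Q x × ¬ P x) xs →
                         length (filter P? xs) < length (filter Q? xs)
  filter-length-strict (x ∷ xs) (h ∷ hs) (here (q , ¬p)) with P? x | Q? x
  ... | yes p | _     = contradiction p ¬p
  ... | no _  | yes _ = s≤s (filter-length-mono xs hs)
  ... | no _  | no ¬q = contradiction q ¬q
  filter-length-strict (x ∷ xs) (h ∷ hs) (there a) with P? x | Q? x
  ... | yes p | yes q = s≤s (filter-length-strict xs hs a)
  ... | yes p | no ¬q = contradiction (h p) ¬q
  ... | no ¬p | yes q = m<n⇒m<1+n (filter-length-strict xs hs a)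
  ... | no ¬p | no ¬q = filter-length-strict xs hs a

  filter-cong-local : ∀ xs → All (λ x → (P x → Q x) × (Q x → P x)) xs → filter P? xs ≡ filter Q? xs
  filter-cong-local [] [] = refl
  filter-cong-local (x ∷ xs) ((pq , qp) ∷ hs) with P? x | Q? x
  ... | yes p | yes q = cong (x ∷_) (filter-cong-local xs hs)
  ... | yes p | no ¬q = contradiction (pq p) ¬q
  ... | no ¬p | yes q = contradiction (qp q) ¬p
  ... | no ¬p | no ¬q = filter-cong-local xs hs

sum-strict : (f g : ℕ → ℕ) → ∀ xs → All (λ x → f x ≤ g x) xs → Any (λ x → f x < g x) xs →
             sum (map f xs) < sum (map g xs)
sum-strict f g (x ∷ xs) (h ∷ hs) (here lt) = +-mono-<-≤ lt (sum-mono xs hs)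
  where
  sum-mono : ∀ xs → All (λ x → f x ≤ g x) xs → sum (map f xs) ≤ sum (map g xs)
  sum-mono [] [] = z≤n
  sum-mono (x ∷ xs) (h ∷ hs) = +-mono-≤ h (sum-mono xs hs)
sum-strict f g (x ∷ xs) (h ∷ hs) (there a) = +-mono-≤-< h (sum-strict f g xs hs a)

Inversion : List ℕ → ℕ → ℕ → Set
Inversion w p q = p < q × at w q < at w p

inversionsFrom : List ℕ → ℕ → ℕ → ℕ
inversionsFrom w m p = length (filter (λ q → (p <? q) ×-dec (at w q <? at w p)) (upTo m))

invCount-< : (w w' : List ℕ) → length w ≡ length w' →
  (∀ {p q} → q < length w → Inversion w p q → Inversion w' p q) →
  ∀ {a b} → b < length w → Inversion w' a b → ¬ Inversion w a b →
  invCount w < invCount w'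
invCount-< w w' len-eq keeps {a} {b} b<m new old =
  subst (λ m' → sum (map (inversionsFrom w m) (upTo m)) < sum (map (inversionsFrom w' m') (upTo m')))
        len-eq
    (sum-strict (inversionsFrom w m) (inversionsFrom w' m) (upTo m)
      (applyUpTo⁺₁ (λ x → x) m (λ _ →
         filter-length-mono _ _ (upTo m) (applyUpTo⁺₁ (λ x → x) m (λ q<m → keeps q<m))))
      (applyUpTo⁺ (λ x → x) {i = a}
         (filter-length-strict _ _ (upTo m) (applyUpTo⁺₁ (λ x → x) m (λ q<m → keeps q<m))
            (applyUpTo⁺ (λ x → x) (new , old) b<m))
         (<-trans (proj₁ new) b<m)))
  where
  m : ℕ
  m = length w

at-map : ∀ (f : ℕ → ℕ) w k → k < length w → at (map f w) k ≡ f (at w k)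
at-map f (x ∷ w) zero    _         = refl
at-map f (x ∷ w) (suc k) (s≤s lt) = at-map f w k lt

at-applyUpTo : ∀ (f : ℕ → ℕ) m k → k < m → at (applyUpTo f m) k ≡ f k
at-applyUpTo f (suc m) zero    _         = refl
at-applyUpTo f (suc m) (suc k) (s≤s lt) = at-applyUpTo (λ x → f (suc x)) m k lt

at-ext : ∀ (xs ys : List ℕ) → length xs ≡ length ys → (∀ {k} → k < length xs → at xs k ≡ at ys k) → xs ≡ ys
at-ext []       []       _ _ = refl
at-ext (x ∷ xs) (y ∷ ys) e h = cong₂ _∷_ (h z<s) (at-ext xs ys (suc-injective e) (λ lt → h (s≤s lt)))

at-allAt : ∀ {P : Pred ℕ 0ℓ} (L : List ℕ) k → All P L → k < length L → P (at L k)
at-allAt (x ∷ L) zero    (p ∷ _)  _         = p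
at-allAt (x ∷ L) (suc k) (_ ∷ ps) (s≤s lt) = at-allAt L k ps lt

at-++ʳ : ∀ (A R : List ℕ) k → at (A ++ R) (length A + k) ≡ at R k
at-++ʳ []      R k = refl
at-++ʳ (_ ∷ A) R k = at-++ʳ A R k

at-middle : ∀ (A R : List ℕ) x → at (A ++ x ∷ R) (length A) ≡ x
at-middle []      R x = refl
at-middle (_ ∷ A) R x = at-middle A R x

at-except₁ : ∀ {P : Pred ℕ 0ℓ} (A R : List ℕ) x → All P A → All P R →
  ∀ {k} → k < length (A ++ x ∷ R) → k ≢ length A → P (at (A ++ x ∷ R) k)
at-except₁ []      R x _        pR {zero}  _         ne = contradiction refl ne
at-except₁ []      R x _        pR {suc k} (s≤s lt) _  = at-allAt R k pR lt
at-except₁ (_ ∷ A) R x (p ∷ _)  pR {zero}  _         _  = p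
at-except₁ (_ ∷ A) R x (_ ∷ pA) pR {suc k} (s≤s lt) ne = at-except₁ A R x pA pR lt (λ e → ne (cong suc e))

at-except₂ : ∀ {P : Pred ℕ 0ℓ} (A B C : List ℕ) x y → All P A → All P B → All P C →
  ∀ {k} → k < length (A ++ x ∷ B ++ y ∷ C) → k ≢ length A → k ≢ length A + suc (length B) →
  P (at (A ++ x ∷ B ++ y ∷ C) k)
at-except₂ []      B C x y _        pB pC {zero}  _         ne _   = contradiction refl ne
at-except₂ []      B C x y _        pB pC {suc k} (s≤s lt) _  ne′ =
  at-except₁ B C y pB pC lt (λ e → ne′ (cong suc e))
at-except₂ (_ ∷ A) B C x y (p ∷ _)  pB pC {zero}  _         _  _   = p
at-except₂ (_ ∷ A) B C x y (_ ∷ pA) pB pC {suc k} (s≤s lt) ne ne′ =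
  at-except₂ A B C x y pA pB pC lt (λ e → ne (cong suc e)) (λ e → ne′ (cong suc e))

Avoid : ℕ → ℕ → Set
Avoid v z = z ≢ v × z ≢ suc v

swapVal : ℕ → ℕ → ℕ
swapVal v x with x ≟ v | x ≟ suc v
... | yes _ | _     = suc v
... | no _  | yes _ = v
... | no _  | no _  = x

swapVal-v : ∀ v → swapVal v v ≡ suc v
swapVal-v v with v ≟ v
... | yes _ = refl
... | no ne = contradiction refl ne

swapVal-suc : ∀ v → swapVal v (suc v) ≡ v
swapVal-suc v with suc v ≟ v | suc v ≟ suc v
... | yes e | _     = contradiction (sym e) (<⇒≢ (n<1+n v))
... | no _  | yes _ = refl
... | no _  | no ne = contradiction refl ne

swapVal-fix : ∀ v {x} → Avoid v x → swapVal v x ≡ x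
swapVal-fix v {x} (x≢v , x≢sv) with x ≟ v | x ≟ suc v
... | yes e | _     = contradiction e x≢v
... | no _  | yes e = contradiction e x≢sv
... | no _  | no _  = refl

swapVal-mono : ∀ v {x y} → y < x → ¬ (x ≡ suc v × y ≡ v) → swapVal v y < swapVal v x
swapVal-mono v {x} {y} y<x exception with y ≟ v | y ≟ suc v | x ≟ v | x ≟ suc v
... | yes refl | _        | yes refl | _        = contradiction y<x (<-irrefl refl)
... | yes refl | _        | no _     | yes x≡sv = contradiction (x≡sv , refl) exception
... | yes refl | _        | no _     | no x≢sv  = ≤∧≢⇒< y<x (λ e → x≢sv (sym e))
... | no _     | yes refl | yes refl | _        = contradiction y<x (<-asym (n<1+n v))
... | no _     | yes refl | no _     | yes refl = contradiction y<x (<-irrefl refl)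
... | no _     | yes refl | no _     | no _     = <-trans (n<1+n v) y<x
... | no _     | no _     | yes refl | _        = <-trans y<x (n<1+n v)
... | no y≢v   | no _     | no _     | yes refl = ≤∧≢⇒< (s≤s⁻¹ y<x) y≢v
... | no _     | no _     | no _     | no _     = y<x

swapPos-at : ∀ a b w {k} → k < length w →
  at (swapPos a b w) k ≡ (if ⌊ k ≟ a ⌋ then at w b else (if ⌊ k ≟ b ⌋ then at w a else at w k))
swapPos-at a b w {k} lt =
  trans (at-map _ (upTo (length w)) k (subst (k <_) (sym (length-upTo (length w))) lt))
        (cong (λ i → if ⌊ i ≟ a ⌋ then at w b else (if ⌊ i ≟ b ⌋ then at w a else at w i))
              (at-applyUpTo (λ i → i) (length w) k lt))

record Occurrences (w : List ℕ) (v a b : ℕ) : Set where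
  field
    at-a      : at w a ≡ v
    at-b      : at w b ≡ suc v
    elsewhere : ∀ {k} → k < length w → k ≢ a → k ≢ b → Avoid v (at w k)

module Cover {w : List ℕ} {v a b : ℕ} (a<b : a < b) (b<len : b < length w) (occ : Occurrences w v a b) where
  open Occurrences occ

  σw : List ℕ
  σw = map (swapVal v) w

  swap-entry : ∀ {k} → k < length w → at (swapPos a b w) k ≡ swapVal v (at w k)
  swap-entry {k} lt rewrite swapPos-at a b w lt with k ≟ a | k ≟ b
  ... | yes refl | _        = begin
          at w b             ≡⟨ at-b ⟩
          suc v              ≡⟨ sym (swapVal-v v) ⟩
          swapVal v v        ≡⟨ cong (swapVal v) (sym at-a) ⟩
          swapVal v (at w a) ∎
    where open ≡-Reasoning
  ... | no _     | yes refl = begin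
          at w a             ≡⟨ at-a ⟩
          v                  ≡⟨ sym (swapVal-suc v) ⟩
          swapVal v (suc v)  ≡⟨ cong (swapVal v) (sym at-b) ⟩
          swapVal v (at w b) ∎
    where open ≡-Reasoning
  ... | no k≢a   | no k≢b   = sym (swapVal-fix v (elsewhere lt k≢a k≢b))

  swapPos≡σw : swapPos a b w ≡ σw
  swapPos≡σw = at-ext (swapPos a b w) σw (trans len-swap (sym (length-map (swapVal v) w)))
    (λ {k} lt → entry (subst (k <_) len-swap lt))
    where
    entry : ∀ {k} → k < length w → at (swapPos a b w) k ≡ at σw k
    entry {k} lt = trans (swap-entry lt) (sym (at-map (swapVal v) w k lt))
    len-swap : length (swapPos a b w) ≡ length w
    len-swap = trans (length-map _ (upTo (length w))) (length-upTo (length w))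

  only-a : ∀ {k} → k < length w → at w k ≡ v → k ≡ a
  only-a {k} lt e with k ≟ a | k ≟ b
  ... | yes k≡a | _        = k≡a
  ... | no _    | yes refl = contradiction (trans (sym at-b) e) (λ sv≡v → <-irrefl (sym sv≡v) (n<1+n v))
  ... | no k≢a  | no k≢b   = contradiction e (proj₁ (elsewhere lt k≢a k≢b))

  only-b : ∀ {k} → k < length w → at w k ≡ suc v → k ≡ b
  only-b {k} lt e with k ≟ a | k ≟ b
  ... | yes refl | _        = contradiction (trans (sym at-a) e) (λ v≡sv → <-irrefl v≡sv (n<1+n v))
  ... | no _     | yes k≡b  = k≡b
  ... | no k≢a   | no k≢b   = contradiction e (proj₂ (elsewhere lt k≢a k≢b))

  -- Every inversion of w is one of σw: the pair (v + 1, v) in decreasing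
  -- order would need v + 1 before v.
  keeps : ∀ {p q} → q < length w → Inversion w p q → Inversion σw p q
  keeps {p} {q} q<m (p<q , lt) =
    p<q , subst₂ _<_ (sym (at-map (swapVal v) w q q<m)) (sym (at-map (swapVal v) w p p<m))
                     (swapVal-mono v lt exceptional)
    where
    p<m : p < length w
    p<m = <-trans p<q q<m
    exceptional : ¬ (at w p ≡ suc v × at w q ≡ v)
    exceptional (ep , eq) = <-asym a<b (subst₂ _<_ (only-b p<m ep) (only-a q<m eq) p<q)

  new : Inversion σw a b
  new = a<b , subst₂ _<_ (sym σw-b) (sym σw-a) (n<1+n v)
    where
    σw-a : at σw a ≡ suc v
    σw-a = trans (at-map (swapVal v) w a (<-trans a<b b<len)) (trans (cong (swapVal v) at-a) (swapVal-v v))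
    σw-b : at σw b ≡ v
    σw-b = trans (at-map (swapVal v) w b b<len) (trans (cong (swapVal v) at-b) (swapVal-suc v))

  old : ¬ Inversion w a b
  old (_ , lt) = <-asym (n<1+n v) (subst₂ _<_ at-b at-a lt)

  cover : BruhatStep w σw
  cover = a , b , a<b , b<len , sym swapPos≡σw ,
          invCount-< w σw (sym (length-map (swapVal v) w)) keeps b<len new old

cover-++ : ∀ {v} (A B C : List ℕ) → All (Avoid v) A → All (Avoid v) B → All (Avoid v) C →
  BruhatStep (A ++ v ∷ B ++ suc v ∷ C) (A ++ suc v ∷ B ++ v ∷ C)
cover-++ {v} A B C avA avB avC = subst (BruhatStep L) σL≡ (Cover.cover a<b b<len occ)
  where
  L : List ℕ
  L = A ++ v ∷ B ++ suc v ∷ C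

  a<b : length A < length A + suc (length B)
  a<b = m<m+n (length A) z<s

  b<len : length A + suc (length B) < length L
  b<len = subst (length A + suc (length B) <_)
            (sym (trans (length-++ A) (cong (λ t → length A + suc t) (length-++ B))))
            (+-monoʳ-< (length A) (s<s (m<m+n (length B) z<s)))

  occ : Occurrences L v (length A) (length A + suc (length B))
  occ = record
    { at-a      = at-middle A (B ++ suc v ∷ C) v
    ; at-b      = trans (at-++ʳ A (v ∷ B ++ suc v ∷ C) (suc (length B))) (at-middle B C (suc v))
    ; elsewhere = at-except₂ A B C v (suc v) avA avB avC
    }

  fixed : ∀ {X} → All (Avoid v) X → map (swapVal v) X ≡ X
  fixed avX = map-id-local (All.map (swapVal-fix v) avX)

  σL≡ : map (swapVal v) L ≡ A ++ suc v ∷ B ++ v ∷ C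
  σL≡ = trans (map-++ (swapVal v) A (v ∷ B ++ suc v ∷ C))
          (cong₂ _++_ (fixed avA) (cong₂ _∷_ (swapVal-v v)
            (trans (map-++ (swapVal v) B (suc v ∷ C))
              (cong₂ _++_ (fixed avB) (cong₂ _∷_ (swapVal-suc v) (fixed avC))))))

avoid? : (a b : ℕ) → Decidable (λ z → z ≢ a × z ≢ b)
avoid? a b z = ¬? (z ≟ a) ×-dec ¬? (z ≟ b)

W : ℕ → ℕ → ℕ → List ℕ
W n a b = filter (avoid? a b) (reverse (upTo n)) ++ a ∷ b ∷ []

below : ∀ v → All (_< v) (downFrom v)
below zero    = []
below (suc v) = n<1+n v ∷ All.map m<n⇒m<1+n (below v)

downFrom-split : ∀ {v n} → suc v < n → ∃[ U ] All (suc v <_) U × downFrom n ≡ U ++ suc v ∷ v ∷ downFrom v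
downFrom-split {v} {suc m} (s≤s v<m) with m≤n⇒m<n∨m≡n v<m
... | inj₂ refl = [] , [] , refl
... | inj₁ sv<m with downFrom-split sv<m
...   | U , above , e = m ∷ U , sv<m ∷ above , cong (m ∷_) e

module _ {P Q : Pred ℕ 0ℓ} (P? : Decidable P) (Q? : Decidable Q) {v : ℕ}
         (P-v : P v) (¬P-sv : ¬ P (suc v)) (Q-sv : Q (suc v)) (¬Q-v : ¬ Q v)
         (agree : ∀ {z} → Avoid v z → (P z → Q z) × (Q z → P z)) where

  filter-downFrom-split : ∀ {n} → suc v < n → ∃[ A ] ∃[ B ] All (Avoid v) A × All (Avoid v) B ×
    filter P? (downFrom n) ≡ A ++ v ∷ B × filter Q? (downFrom n) ≡ A ++ suc v ∷ B
  filter-downFrom-split {n} lt with downFrom-split lt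
  ... | U , above , e = filter P? U , filter P? D , filter⁺ P? avU , filter⁺ P? avD , eP , eQ
    where
    open ≡-Reasoning
    D : List ℕ
    D = downFrom v

    avU : All (Avoid v) U
    avU = All.map (λ sv<z → (λ z≡v → <-asym (n<1+n v) (subst (suc v <_) z≡v sv<z)) ,
                            (λ z≡sv → <-irrefl (sym z≡sv) sv<z)) above
    avD : All (Avoid v) D
    avD = All.map (λ z<v → <⇒≢ z<v , (λ z≡sv → <-asym (n<1+n v) (subst (_< v) z≡sv z<v))) (below v)

    eP : filter P? (downFrom n) ≡ filter P? U ++ v ∷ filter P? D
    eP = begin
      filter P? (downFrom n)                       ≡⟨ cong (filter P?) e ⟩
      filter P? (U ++ suc v ∷ v ∷ D)               ≡⟨ filter-++ P? U (suc v ∷ v ∷ D) ⟩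
      filter P? U ++ filter P? (suc v ∷ v ∷ D)     ≡⟨ cong (filter P? U ++_)
                                                        (trans (filter-reject P? ¬P-sv) (filter-accept P? P-v)) ⟩
      filter P? U ++ v ∷ filter P? D               ∎

    same : ∀ {X} → All (Avoid v) X → filter Q? X ≡ filter P? X
    same avX = filter-cong-local Q? P? _ (All.map (λ av → proj₂ (agree av) , proj₁ (agree av)) avX)

    eQ : filter Q? (downFrom n) ≡ filter P? U ++ suc v ∷ filter P? D
    eQ = begin
      filter Q? (downFrom n)                       ≡⟨ cong (filter Q?) e ⟩
      filter Q? (U ++ suc v ∷ v ∷ D)               ≡⟨ filter-++ Q? U (suc v ∷ v ∷ D) ⟩
      filter Q? U ++ filter Q? (suc v ∷ v ∷ D)     ≡⟨ cong₂ _++_ (same avU)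
                                                        (trans (filter-accept Q? Q-sv)
                                                          (cong (suc v ∷_) (trans (filter-reject Q? ¬Q-v) (same avD)))) ⟩
      filter P? U ++ suc v ∷ filter P? D           ∎

lower-first : ∀ {n v x} → suc v < n → Avoid v x → BruhatStep (W n (suc v) x) (W n v x)
lower-first {n} {v} {x} lt (x≢v , x≢sv)
  with filter-downFrom-split (avoid? (suc v) x) (avoid? v x)
         ((λ v≡sv → <-irrefl v≡sv (n<1+n v)) , (λ v≡x → x≢v (sym v≡x))) (λ p → proj₁ p refl)
         ((λ sv≡v → <-irrefl (sym sv≡v) (n<1+n v)) , (λ sv≡x → x≢sv (sym sv≡x))) (λ q → proj₁ q refl)
         (λ (z≢v , z≢sv) → (λ (_ , z≢x) → z≢v , z≢x) , (λ (_ , z≢x) → z≢sv , z≢x)) lt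
... | A , B , avA , avB , eP , eQ
  rewrite reverse-upTo n | eP | eQ | ++-assoc A (v ∷ B) (suc v ∷ x ∷ []) | ++-assoc A (suc v ∷ B) (v ∷ x ∷ [])
  = cover-++ A B (x ∷ []) avA avB ((x≢v , x≢sv) ∷ [])

lower-second : ∀ {n v x} → suc v < n → Avoid v x → BruhatStep (W n x (suc v)) (W n x v)
lower-second {n} {v} {x} lt (x≢v , x≢sv)
  with filter-downFrom-split (avoid? x (suc v)) (avoid? x v)
         ((λ v≡x → x≢v (sym v≡x)) , (λ v≡sv → <-irrefl v≡sv (n<1+n v))) (λ p → proj₂ p refl)
         ((λ sv≡x → x≢sv (sym sv≡x)) , (λ sv≡v → <-irrefl (sym sv≡v) (n<1+n v))) (λ q → proj₂ q refl)
         (λ (z≢v , z≢sv) → (λ (z≢x , _) → z≢x , z≢v) , (λ (z≢x , _) → z≢x , z≢sv)) lt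
... | A , B , avA , avB , eP , eQ
  rewrite reverse-upTo n | eP | eQ | ++-assoc A (v ∷ B) (x ∷ suc v ∷ []) | ++-assoc A (suc v ∷ B) (x ∷ v ∷ [])
  = subst₂ BruhatStep (cong (λ t → A ++ v ∷ t) (++-assoc B (x ∷ []) (suc v ∷ [])))
                      (cong (λ t → A ++ suc v ∷ t) (++-assoc B (x ∷ []) (v ∷ [])))
      (cover-++ A (B ++ x ∷ []) [] avA (++⁺ avB ((x≢v , x≢sv) ∷ [])) [])

-- Shifting α = ε_a - ε_b down by one: lower the smaller entry first, so that
-- the two entries never collide.
shift-down : ∀ {n a b} → a ≢ b → suc a < n → suc b < n → W n (suc a) (suc b) ≤B W n a b
shift-down {n} {a} {b} a≢b la lb with <-cmp a b
... | tri< a<b _ _ = lower-first la ((λ sb≡a → <-asym a<b (subst (b <_) sb≡a (n<1+n b))) ,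
                                     (λ sb≡sa → a≢b (sym (suc-injective sb≡sa))))
                   ◅ lower-second lb (a≢b , (λ a≡sb → <-asym a<b (subst (b <_) (sym a≡sb) (n<1+n b))))
                   ◅ ε
... | tri≈ _ a≡b _ = contradiction a≡b a≢b
... | tri> _ _ b<a = lower-second lb ((λ sa≡b → <-asym b<a (subst (a <_) sa≡b (n<1+n a))) ,
                                      (λ sa≡sb → a≢b (suc-injective sa≡sb)))
                   ◅ lower-first la ((λ b≡a → a≢b (sym b≡a)) ,
                                     (λ b≡sa → <-asym b<a (subst (a <_) (sym b≡sa) (n<1+n a))))
                   ◅ ε

shift-chain : ∀ {n a b} t → a ≢ b → t + a < n → t + b < n → W n (t + a) (t + b) ≤B W n a b
shift-chain zero    a≢b la lb = ε
shift-chain (suc t) a≢b la lb =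
  shift-down (λ e → a≢b (+-cancelˡ-≡ t _ _ e)) la lb
  ◅◅ shift-chain t a≢b (<-trans (n<1+n _) la) (<-trans (n<1+n _) lb)

height-eq : ∀ i j k l → + j - + i ≡ + l - + k → j + k ≡ l + i
height-eq i j k l e = ℤₚ.+-injective (begin
  + j ℤ.+ + k                  ≡⟨ sym (regroup (+ j) (+ i) (+ k)) ⟩
  (+ j - + i) ℤ.+ (+ i ℤ.+ + k) ≡⟨ cong₂ ℤ._+_ e (ℤₚ.+-comm (+ i) (+ k)) ⟩
  (+ l - + k) ℤ.+ (+ k ℤ.+ + i) ≡⟨ regroup (+ l) (+ k) (+ i) ⟩
  + l ℤ.+ + i                  ∎)
  where
  open ≡-Reasoning
  regroup : ∀ (x y z : ℤ.ℤ) → (x - y) ℤ.+ (y ℤ.+ z) ≡ x ℤ.+ z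
  regroup = solve-∀

shifted : ∀ {a b c d} → a ≤ c → b + c ≡ d + a → c ≡ (c ∸ a) + a × d ≡ (c ∸ a) + b
shifted {a} {b} {c} {d} a≤c e = sym (m∸n+n≡m a≤c) , +-cancelʳ-≡ a d ((c ∸ a) + b) (begin
  d + a             ≡⟨ sym e ⟩
  b + c             ≡⟨ cong (λ x → b + x) (sym (m∸n+n≡m a≤c)) ⟩
  b + ((c ∸ a) + a) ≡⟨ sym (+-assoc b (c ∸ a) a) ⟩
  b + (c ∸ a) + a   ≡⟨ cong (_+ a) (+-comm b (c ∸ a)) ⟩
  (c ∸ a) + b + a   ∎)
  where open ≡-Reasoning

equal-height : ∀ {n a b c d} → a ≢ b → a ≤ c → b + c ≡ d + a → c < n → d < n → W n c d ≤B W n a b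
equal-height {n} {a} {b} {c} {d} a≢b a≤c e c<n d<n with shifted a≤c e
... | c≡ , d≡ = subst₂ (λ x y → W n x y ≤B W n a b) (sym c≡) (sym d≡)
                  (shift-chain (c ∸ a) a≢b (subst (_< n) c≡ c<n) (subst (_< n) d≡ d<n))

mainTheorem1 : (n : ℕ) → 3 ≤ n → (i j k l : Fin n) → i ≢ j → k ≢ l →
    ht i j ≡ ht k l →
    (wRoot n i j ≤B wRoot n k l) ⊎ (wRoot n k l ≤B wRoot n i j)
mainTheorem1 n _ i j k l i≢j k≢l e with ≤-total (toℕ i) (toℕ k)
... | inj₁ i≤k = inj₂ (equal-height (λ e′ → i≢j (toℕ-injective e′)) i≤k
                        (height-eq (toℕ i) (toℕ j) (toℕ k) (toℕ l) e) (toℕ<n k) (toℕ<n l))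
... | inj₂ k≤i = inj₁ (equal-height (λ e′ → k≢l (toℕ-injective e′)) k≤i
                        (height-eq (toℕ k) (toℕ l) (toℕ i) (toℕ j) (sym e)) (toℕ<n i) (toℕ<n j))
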